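{- Let $G$ be an msp-digraph. Then $\chi_o(G)\leq 7$.
   Context: A source is a vertex of indegree $0$, a sink a vertex of outdegree $0$. For vertex-disjoint digraphs $G_1=(V_1,E_1)$, $G_2=(V_2,E_2)$, let $O_1$ be the set of sinks of $G_1$ and $I_2$ the set of sources of $G_2$. The parallel composition is $G_1\cup G_2=(V_1\cup V_2,E_1\cup E_2)$; the series composition is $G_1\times G_2=(V_1\cup V_2,E_1\cup E_2\cup\{(v,w)\mid v\in O_1, w\in I_2\})$. Msp-digraphs are defined recursively: every single-vertex digraph is an msp-digraph, and if $G_1,G_2$ are vertex-disjoint msp-digraphs then $G_1\cup G_2$ and $G_1\times G_2$ are msp-digraphs. An oriented $r$-coloring of an oriented graph $G=(V,E)$ is a map $c:V\to\{1,\dots,r\}$ with $c(u)\neq c(v)$ for every $(u,v)\in E$, and $c(u)\neq c(y)$ for every two arcs $(u,v),(x,y)\in E$ with $c(v)=c(x)$; $\chi_o(G)$ is the smallest such $r$. -}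

module Defs where

open import Data.Empty using (⊥)
open import Data.Unit using (⊤)
open import Data.Sum using (_⊎_; inj₁; inj₂)
open import Data.Product using (_×_; Σ)
open import Data.Nat using (ℕ)
open import Data.Fin using (Fin)
open import Relation.Nullary using (¬_)
open import Relation.Binary.PropositionalEquality using (_≡_; _≢_)

record Digraph : Set₁ where
  constructor digraph
  field
    V : Set
    E : V → V → Set
open Digraph public

IsSink : (G : Digraph) → V G → Set
IsSink G v = ∀ w → ¬ E G v w

IsSource : (G : Digraph) → V G → Set
IsSource G w = ∀ v → ¬ E G v w

single : Digraph
single = digraph ⊤ (λ _ _ → ⊥)

parArcs : (G₁ G₂ : Digraph) → (V G₁ ⊎ V G₂) → (V G₁ ⊎ V G₂) → Set
parArcs G₁ G₂ (inj₁ a) (inj₁ b) = E G₁ a b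
parArcs G₁ G₂ (inj₂ a) (inj₂ b) = E G₂ a b
parArcs G₁ G₂ (inj₁ a) (inj₂ b) = ⊥
parArcs G₁ G₂ (inj₂ a) (inj₁ b) = ⊥

_∪ᴳ_ : Digraph → Digraph → Digraph
G₁ ∪ᴳ G₂ = digraph (V G₁ ⊎ V G₂) (parArcs G₁ G₂)

serArcs : (G₁ G₂ : Digraph) → (V G₁ ⊎ V G₂) → (V G₁ ⊎ V G₂) → Set
serArcs G₁ G₂ (inj₁ a) (inj₁ b) = E G₁ a b
serArcs G₁ G₂ (inj₂ a) (inj₂ b) = E G₂ a b
serArcs G₁ G₂ (inj₁ a) (inj₂ b) = IsSink G₁ a × IsSource G₂ b
serArcs G₁ G₂ (inj₂ a) (inj₁ b) = ⊥

_×ᴳ_ : Digraph → Digraph → Digraph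
G₁ ×ᴳ G₂ = digraph (V G₁ ⊎ V G₂) (serArcs G₁ G₂)

data IsMSP : Digraph → Set₁ where
  msp-single : IsMSP single
  msp-par    : ∀ {G₁ G₂} → IsMSP G₁ → IsMSP G₂ → IsMSP (G₁ ∪ᴳ G₂)
  msp-ser    : ∀ {G₁ G₂} → IsMSP G₁ → IsMSP G₂ → IsMSP (G₁ ×ᴳ G₂)

IsOrientedColoring : (G : Digraph) (r : ℕ) → (V G → Fin r) → Set
IsOrientedColoring G r c =
  (∀ u v → E G u v → c u ≢ c v) ×
  (∀ u v x y → E G u v → E G x y → c v ≡ c x → c u ≢ c y)

-- χ_o(G) ≤ r  iff  G has an oriented r-coloring (colors need not all be used)
χo≤ : Digraph → ℕ → Set
χo≤ G r = Σ (V G → Fin r) (IsOrientedColoring G r)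

-- Every msp-digraph maps homomorphically into the Paley tournament on ℤ/7, whose arcs are
-- a → a + s for s ∈ {1, 2, 4}; a homomorphism into a tournament is an oriented colouring.
-- The induction carries a stronger invariant: for every arc p → q of the target, there is a
-- homomorphism sending all sources into the out-neighbourhood of p and all sinks onto q.
-- Parallel composition preserves it trivially; for a series composition G₁ × G₂ choose m
-- with p → m → q, colour G₁ anchored at (p, m) and G₂ at (m, q): the new arcs then run from
-- colour m into the out-neighbourhood of m. Such an m exists in the Paley tournament: the
-- midpoint (p + q)/2, because halving permutes the nonzero squares mod 7.
module Submission where

open import Defs
open import Data.Bool using (T)
open import Data.Bool.ListAction using (any)
open import Data.Empty using (⊥-elim)
open import Data.Fin using (Fin; toℕ; zero; suc)
open import Data.Fin.Properties using (all?)
open import Data.List using (List; []; _∷_)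
open import Data.Nat using (ℕ; _+_; _*_; _%_; _≡ᵇ_)
open import Data.Nat.DivMod using (_mod_)
open import Data.Product using (Σ; _,_)
open import Data.Sum using (inj₁; inj₂; [_,_])
open import Data.Unit using (tt)
open import Function using (_∘_; const)
open import Relation.Binary.Definitions using (Decidable; Irreflexive; Asymmetric; Dense)
open import Relation.Binary.PropositionalEquality using (_≡_; refl; sym; subst; subst₂)
open import Relation.Nullary.Decidable using (T?; ¬?; map′; _×-dec_; _→-dec_; toWitness)

Hom : (G : Digraph) {A : Set} → (A → A → Set) → (V G → A) → Set
Hom G _⇒_ φ = ∀ u v → E G u v → φ u ⇒ φ v

hom⇒orientedColoring : ∀ {G r} {_⇒_ : Fin r → Fin r → Set} {c : V G → Fin r} →
                       Irreflexive _≡_ _⇒_ → Asymmetric _⇒_ →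
                       Hom G _⇒_ c → IsOrientedColoring G r c
hom⇒orientedColoring {_⇒_ = _⇒_} irrefl asym hom =
  (λ u v uv cu≡cv → irrefl cu≡cv (hom u v uv)) ,
  (λ u v x y uv xy cv≡cx cu≡cy → asym (hom u v uv) (subst₂ _⇒_ (sym cv≡cx) (sym cu≡cy) (hom x y xy)))

msp⇒source : ∀ {G} → IsMSP G → Σ (V G) (IsSource G)
msp⇒source msp-single = tt , λ _ ()
msp⇒source (msp-par {G₁} {G₂} G₁-msp _) with msp⇒source G₁-msp
... | s , s-source = inj₁ s , source
  where
  source : IsSource (G₁ ∪ᴳ G₂) (inj₁ s)
  source (inj₁ v) = s-source v
  source (inj₂ v) ()
msp⇒source (msp-ser {G₁} {G₂} G₁-msp _) with msp⇒source G₁-msp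
... | s , s-source = inj₁ s , source
  where
  source : IsSource (G₁ ×ᴳ G₂) (inj₁ s)
  source (inj₁ v) = s-source v
  source (inj₂ v) ()

msp⇒sink : ∀ {G} → IsMSP G → Σ (V G) (IsSink G)
msp⇒sink msp-single = tt , λ _ ()
msp⇒sink (msp-par {G₁} {G₂} G₁-msp _) with msp⇒sink G₁-msp
... | t , t-sink = inj₁ t , sink
  where
  sink : IsSink (G₁ ∪ᴳ G₂) (inj₁ t)
  sink (inj₁ w) = t-sink w
  sink (inj₂ w) ()
msp⇒sink (msp-ser {G₁} {G₂} _ G₂-msp) with msp⇒sink G₂-msp
... | t , t-sink = inj₂ t , sink
  where
  sink : IsSink (G₁ ×ᴳ G₂) (inj₂ t)
  sink (inj₁ w) ()
  sink (inj₂ w) = t-sink w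

module _ {A : Set} (_⇒_ : A → A → Set) where

  record AnchoredHom (G : Digraph) (p q : A) : Set where
    field
      colour  : V G → A
      hom     : Hom G _⇒_ colour
      sources : ∀ v → IsSource G v → p ⇒ colour v
      sinks   : ∀ v → IsSink G v → colour v ≡ q

  open AnchoredHom

  single-anchoredHom : ∀ {p q} → p ⇒ q → AnchoredHom single p q
  single-anchoredHom p⇒q = record
    { colour = const _ ; hom = λ _ _ () ; sources = λ _ _ → p⇒q ; sinks = λ _ _ → refl }

  ∪-anchoredHom : ∀ {G₁ G₂ p q} → AnchoredHom G₁ p q → AnchoredHom G₂ p q →
                  AnchoredHom (G₁ ∪ᴳ G₂) p q
  ∪-anchoredHom {G₁} {G₂} {p} {q} φ₁ φ₂ = record
    { colour = [ colour φ₁ , colour φ₂ ] ; hom = hom′ ; sources = sources′ ; sinks = sinks′ }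
    where
    hom′ : Hom (G₁ ∪ᴳ G₂) _⇒_ [ colour φ₁ , colour φ₂ ]
    hom′ (inj₁ a) (inj₁ b) ab = hom φ₁ a b ab
    hom′ (inj₂ a) (inj₂ b) ab = hom φ₂ a b ab

    sources′ : ∀ v → IsSource (G₁ ∪ᴳ G₂) v → p ⇒ [ colour φ₁ , colour φ₂ ] v
    sources′ (inj₁ a) a-source = sources φ₁ a (a-source ∘ inj₁)
    sources′ (inj₂ b) b-source = sources φ₂ b (b-source ∘ inj₂)

    sinks′ : ∀ v → IsSink (G₁ ∪ᴳ G₂) v → [ colour φ₁ , colour φ₂ ] v ≡ q
    sinks′ (inj₁ a) a-sink = sinks φ₁ a (a-sink ∘ inj₁)
    sinks′ (inj₂ b) b-sink = sinks φ₂ b (b-sink ∘ inj₂)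

  ×-anchoredHom : ∀ {G₁ G₂ p m q} → Σ (V G₁) (IsSink G₁) → Σ (V G₂) (IsSource G₂) →
                  AnchoredHom G₁ p m → AnchoredHom G₂ m q → AnchoredHom (G₁ ×ᴳ G₂) p q
  ×-anchoredHom {G₁} {G₂} {p = p} {q = q} (t , t-sink) (s , s-source) φ₁ φ₂ = record
    { colour = [ colour φ₁ , colour φ₂ ] ; hom = hom′ ; sources = sources′ ; sinks = sinks′ }
    where
    hom′ : Hom (G₁ ×ᴳ G₂) _⇒_ [ colour φ₁ , colour φ₂ ]
    hom′ (inj₁ a) (inj₁ b) ab = hom φ₁ a b ab
    hom′ (inj₂ a) (inj₂ b) ab = hom φ₂ a b ab
    hom′ (inj₁ a) (inj₂ b) (a-sink , b-source) =
      subst (_⇒ colour φ₂ b) (sym (sinks φ₁ a a-sink)) (sources φ₂ b b-source)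

    sources′ : ∀ v → IsSource (G₁ ×ᴳ G₂) v → p ⇒ [ colour φ₁ , colour φ₂ ] v
    sources′ (inj₁ a) a-source = sources φ₁ a (a-source ∘ inj₁)
    sources′ (inj₂ b) b-source = ⊥-elim (b-source (inj₁ t) (t-sink , b-source ∘ inj₂))

    sinks′ : ∀ v → IsSink (G₁ ×ᴳ G₂) v → [ colour φ₁ , colour φ₂ ] v ≡ q
    sinks′ (inj₂ b) b-sink = sinks φ₂ b (b-sink ∘ inj₂)
    sinks′ (inj₁ a) a-sink = ⊥-elim (a-sink (inj₂ s) (a-sink ∘ inj₁ , s-source))

  msp⇒anchoredHom : Dense _⇒_ → ∀ {G p q} → IsMSP G → p ⇒ q → AnchoredHom G p q
  msp⇒anchoredHom dense msp-single p⇒q = single-anchoredHom p⇒q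
  msp⇒anchoredHom dense (msp-par G₁-msp G₂-msp) p⇒q =
    ∪-anchoredHom (msp⇒anchoredHom dense G₁-msp p⇒q) (msp⇒anchoredHom dense G₂-msp p⇒q)
  msp⇒anchoredHom dense (msp-ser G₁-msp G₂-msp) p⇒q with dense p⇒q
  ... | m , p⇒m , m⇒q = ×-anchoredHom (msp⇒sink G₁-msp) (msp⇒source G₂-msp)
    (msp⇒anchoredHom dense G₁-msp p⇒m) (msp⇒anchoredHom dense G₂-msp m⇒q)

squares₇ : List ℕ
squares₇ = 1 ∷ 2 ∷ 4 ∷ []

record _⇒₇_ (a b : Fin 7) : Set where
  constructor differenceIsSquare
  field
    isSquare : T (any (λ s → (toℕ a + s) % 7 ≡ᵇ toℕ b) squares₇)

_⇒₇?_ : Decidable _⇒₇_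
a ⇒₇? b = map′ differenceIsSquare _⇒₇_.isSquare (T? _)

⇒₇-irrefl : Irreflexive _≡_ _⇒₇_
⇒₇-irrefl {a} refl = toWitness {a? = all? λ a → ¬? (a ⇒₇? a)} _ a

⇒₇-asym : Asymmetric _⇒₇_
⇒₇-asym {a} {b} =
  toWitness {a? = all? λ a → all? λ b → (a ⇒₇? b) →-dec ¬? (b ⇒₇? a)} _ a b

-- 4 is the inverse of 2 modulo 7.
midpoint₇ : Fin 7 → Fin 7 → Fin 7
midpoint₇ a b = (4 * (toℕ a + toℕ b)) mod 7

⇒₇-dense : Dense _⇒₇_
⇒₇-dense {a} {b} a⇒b = midpoint₇ a b , toWitness {a? = all? λ a → all? λ b →
  (a ⇒₇? b) →-dec ((a ⇒₇? midpoint₇ a b) ×-dec (midpoint₇ a b ⇒₇? b))} _ a b a⇒b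

theorem5p7 : (G : Digraph) → IsMSP G → χo≤ G 7
theorem5p7 G msp = colour , hom⇒orientedColoring ⇒₇-irrefl ⇒₇-asym hom
  where
  zero⇒one : zero ⇒₇ suc zero
  zero⇒one = differenceIsSquare tt

  open AnchoredHom (msp⇒anchoredHom _⇒₇_ ⇒₇-dense msp zero⇒one)
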